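{- Let $G$ be an HRLQ instance in which every hospital has lower and upper quota at most one and every resident's preference list has length at most two. If $M$ and $M^*$ are envy-free matchings of $G$ with $|M^*|>|M|$, then there is an augmenting path $P$ with respect to $M$ such that $M\oplus P$ is envy-free.
   Context: An HRLQ instance is a bipartite graph $G=(\mathcal{R}\cup\mathcal{H},E)$ with residents $\mathcal{R}$ and hospitals $\mathcal{H}$; $(r,h)\in E$ means mutual acceptability. Each hospital $h$ has an upper quota $q^+(h)$ and a lower quota $q^-(h)\le q^+(h)$. Every vertex ranks its neighbours strictly; $b_1>_a b_2$ means $a$ prefers $b_1$. A matching $M\subseteq E$ assigns each resident at most one hospital and each hospital $h$ at most $q^+(h)$ residents; $M(r)$ is $r$'s hospital ($\bot$ if unmatched, worst for $r$). A resident $r$ envies a matched resident $r'$ with $M(r')=h$, $(r,h)\in E$, if $h>_r M(r)$ and $r>_h r'$; $M$ is envy-free if no such pair exists. An augmenting path with respect to $M$ is a path $\langle r_1,h_1,r_2,h_2,\dots,r_n,h_n\rangle$ in $G$ alternating between edges not in $M$ and edges in $M$ (i.e. $(r_i,h_i)\notin M$, $(r_{i+1},h_i)\in M$), starting at a resident $r_1$ unmatched in $M$ and ending at a hospital $h_n$ that is under-subscribed in $M$; $M\oplus P$ is the symmetric difference. -}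

module Defs where

open import Data.Nat using (ℕ; _≤_; _<_)
open import Data.Fin using (Fin)
open import Data.Fin.Properties using (_≟_)
open import Data.Bool using (Bool; true; false; _xor_; _∧_)
open import Data.List using (List; []; _∷_; length; map; filterᵇ; allFin)
open import Data.Bool.ListAction using (any)
open import Data.List.Relation.Unary.All using (All)
open import Data.List.Relation.Unary.Unique.Propositional using (Unique)
open import Data.Product using (_×_; _,_; proj₁; proj₂; Σ; ∃)
open import Relation.Binary.PropositionalEquality using (_≡_; _≢_)
open import Relation.Nullary using (¬_)
open import Data.Empty using (⊥)
open import Data.Unit using (⊤)
import Data.List
open import Relation.Nullary.Decidable using (⌊_⌋)

-- E r h ≡ true  iff  (r , h) is an edge (mutual acceptability).
-- Preferences are given by ranks (smaller rank = more preferred), required to be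
-- injective on neighbours, i.e. strict rankings of the neighbours.
record HRLQ : Set where
  field
    nR nH  : ℕ
    E      : Fin nR → Fin nH → Bool
    rankR  : Fin nR → Fin nH → ℕ
    rankH  : Fin nH → Fin nR → ℕ
    rankR-strict : ∀ r h h′ → E r h ≡ true → E r h′ ≡ true → rankR r h ≡ rankR r h′ → h ≡ h′
    rankH-strict : ∀ h r r′ → E r h ≡ true → E r′ h ≡ true → rankH h r ≡ rankH h r′ → r ≡ r′
    qlow qup : Fin nH → ℕ
    qlow≤qup : ∀ h → qlow h ≤ qup h

module _ (G : HRLQ) where
  open HRLQ G

  prefLength : Fin nR → ℕ
  prefLength r = length (filterᵇ (E r) (allFin nH))

  EdgeSet : Set
  EdgeSet = Fin nR → Fin nH → Bool

  load : EdgeSet → Fin nH → ℕ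
  load M h = length (filterᵇ (λ r → M r h) (allFin nR))

  size : EdgeSet → ℕ
  size M = length (filterᵇ (λ rh → M (proj₁ rh) (proj₂ rh))
                    (Data.List.concatMap (λ r → map (λ h → (r , h)) (allFin nH)) (allFin nR)))

  record IsMatching (M : EdgeSet) : Set where
    field
      ⊆E      : ∀ r h → M r h ≡ true → E r h ≡ true
      resOne  : ∀ r h h′ → M r h ≡ true → M r h′ ≡ true → h ≡ h′
      quota   : ∀ h → load M h ≤ qup h

  -- h >_r M(r)  (an unmatched resident prefers every hospital; ⊥ is worst)
  PrefersToCurrent : EdgeSet → Fin nR → Fin nH → Set
  PrefersToCurrent M r h = ∀ h′ → M r h′ ≡ true → rankR r h < rankR r h′

  Envies : EdgeSet → Fin nR → Fin nR → Set
  Envies M r r′ = Σ (Fin nH) λ h →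
    M r′ h ≡ true × E r h ≡ true × PrefersToCurrent M r h × rankH h r < rankH h r′

  EnvyFree : EdgeSet → Set
  EnvyFree M = ∀ r r′ → ¬ Envies M r r′

  -- A path ⟨r₁,h₁,r₂,h₂,…,rₙ,hₙ⟩ is represented by the list
  -- (r₁ , h₁) ∷ (r₂ , h₂) ∷ … ∷ (rₙ , hₙ) ∷ [].
  Path : Set
  Path = List (Fin nR × Fin nH)

  Linked : EdgeSet → Path → Set
  Linked M []                          = ⊤
  Linked M (_ ∷ [])                    = ⊤
  Linked M ((r , h) ∷ (r′ , h′) ∷ ps)  = M r′ h ≡ true × Linked M ((r′ , h′) ∷ ps)

  pathEdges : Path → List (Fin nR × Fin nH)
  pathEdges []                         = []
  pathEdges ((r , h) ∷ [])             = (r , h) ∷ []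
  pathEdges ((r , h) ∷ (r′ , h′) ∷ ps) = (r , h) ∷ (r′ , h) ∷ pathEdges ((r′ , h′) ∷ ps)

  inPath : Path → Fin nR → Fin nH → Bool
  inPath P r h = any (λ e → ⌊ proj₁ e ≟ r ⌋ ∧ ⌊ proj₂ e ≟ h ⌋) (pathEdges P)

  _⊕_ : EdgeSet → Path → EdgeSet
  (M ⊕ P) r h = M r h xor inPath P r h

  StartsUnmatched : EdgeSet → Path → Set
  StartsUnmatched M []            = ⊥
  StartsUnmatched M ((r , _) ∷ _) = ∀ h → M r h ≡ false

  EndsUnder : EdgeSet → Path → Set
  EndsUnder M []               = ⊥
  EndsUnder M ((_ , h) ∷ [])   = load M h < qup h
  EndsUnder M (_ ∷ p ∷ ps)     = EndsUnder M (p ∷ ps)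

  record IsAugmentingPath (M : EdgeSet) (P : Path) : Set where
    field
      distinctRes  : Unique (map proj₁ P)
      distinctHosp : Unique (map proj₂ P)
      nonMatchingEdges : All (λ e → E (proj₁ e) (proj₂ e) ≡ true × M (proj₁ e) (proj₂ e) ≡ false) P
      matchingEdges    : Linked M P
      start : StartsUnmatched M P
      end   : EndsUnder M P

module Submission where

-- Since |M*| > |M|, the symmetric difference of M and M* contains an augmenting path for M whose
-- non-matching edges lie in M*; it is found by induction on |M*|, deleting one edge of M* and one
-- of M at a time. Augmenting along it can create envy only towards a resident r placed at h by
-- a rival: a resident that h prefers to r and that prefers h to its M-hospital. If some edge
-- (s , k) of the path has a rival, take the last such edge and the rival x of s that k likes
-- best. With preference lists of length two x is unmatched in M (otherwise x would envy s in
-- M*), so x followed by the rest of the path from k is again augmenting, and now no edge has a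
-- rival. Augmenting along such a path keeps the matching envy-free: a resident on the path that
-- envied someone would envy a resident of M* or have three acceptable hospitals.

open import Defs
open import Data.Nat using (ℕ; _≤_; _<_)
open import Data.Product using (_×_; Σ)

open import Data.Nat using (zero; suc; _+_; z≤n; s≤s; s≤s⁻¹; _<?_)
open import Data.Nat.Properties hiding (_≟_)
open import Data.Nat.Induction using (<-wellFounded)
open import Data.Fin using (Fin; zero; suc)
import Data.Fin.Properties as Finₚ
open Finₚ using (_≟_; any?)
open import Data.Bool using (Bool; true; false; not; _∧_; T)
open import Data.Bool.Properties using (∧-identityʳ; ∧-zeroʳ; ¬-not; T-≡; T-∧)
open import Data.List using (List; []; _∷_; length; map; filterᵇ; tabulate; allFin; _++_; concatMap)
open import Data.List.Properties using (length-++; filter-++)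
open import Data.List.Relation.Unary.Any as Any using (here; there)
open import Data.List.Relation.Unary.Any.Properties using (any⁺; any⁻)
open import Data.List.Relation.Unary.All as All using (All; []; _∷_)
import Data.List.Relation.Unary.All.Properties as Allₚ
open import Data.List.Relation.Unary.AllPairs using ([]; _∷_)
open import Data.List.Relation.Unary.Unique.Propositional using (Unique)
open import Data.List.Membership.Propositional using (_∈_; _∉_)
open import Data.List.Membership.Propositional.Properties using (∈-map⁺; ∈-map⁻)
open import Data.Product using (_,_; ∃; proj₁; proj₂)
open import Data.Sum using (_⊎_; inj₁; inj₂; [_,_]′)
open import Data.Empty using (⊥; ⊥-elim)
open import Data.Unit using (tt)
open import Function using (_∘_; id)
open import Function.Bundles using (Equivalence)
open import Induction.WellFounded using (Acc; acc)
open import Relation.Binary.PropositionalEquality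
open import Relation.Nullary using (¬_; Dec; yes; no; does; contradiction)
open import Relation.Nullary.Decidable
  using (_×-dec_; _→-dec_; ⌊_⌋; dec-true; dec-false; toWitness; fromWitness)
open import Algebra.Properties.Monoid.Sum +-0-monoid using (sum; sum-cong-≗; sum-replicate-zero)

≡true⇒≢false : ∀ {b} → b ≡ true → b ≢ false
≡true⇒≢false refl ()

bit : Bool → ℕ
bit false = 0
bit true  = 1

count : ∀ {n} → (Fin n → Bool) → ℕ
count p = sum (bit ∘ p)

sum-≡-suc : ∀ {n} {f g : Fin n → ℕ} i → f i ≡ suc (g i) → (∀ j → j ≢ i → f j ≡ g j) →
            sum f ≡ suc (sum g)
sum-≡-suc {suc n} zero fi≡ rest = cong₂ _+_ fi≡ (sum-cong-≗ λ j → rest (suc j) λ ())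
sum-≡-suc {suc n} {f} {g} (suc i) fi≡ rest = begin
  f zero + sum (f ∘ suc)        ≡⟨ cong₂ _+_ (rest zero λ ()) (sum-≡-suc i fi≡ rest′) ⟩
  g zero + suc (sum (g ∘ suc))  ≡⟨ +-suc (g zero) _ ⟩
  suc (g zero + sum (g ∘ suc))  ∎
  where
  open ≡-Reasoning
  rest′ : ∀ j → j ≢ i → f (suc j) ≡ g (suc j)
  rest′ j j≢i = rest (suc j) (j≢i ∘ Finₚ.suc-injective)

sum-<⇒∃< : ∀ {n} (f g : Fin n → ℕ) → sum f < sum g → ∃ λ i → f i < g i
sum-<⇒∃< {suc n} f g sf<sg with f zero <? g zero
... | yes f₀<g₀ = zero , f₀<g₀
... | no  f₀≮g₀ =
  let i , fi<gi = sum-<⇒∃< (f ∘ suc) (g ∘ suc)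
                    (≰⇒> λ tails≥ → <⇒≱ sf<sg (+-mono-≤ (≮⇒≥ f₀≮g₀) tails≥))
  in suc i , fi<gi

without : ∀ {n} → (Fin n → Bool) → Fin n → Fin n → Bool
without p x i = p i ∧ not (does (i ≟ x))

count-without : ∀ {n} (p : Fin n → Bool) {x} → p x ≡ true → count p ≡ suc (count (without p x))
count-without p {x} px = sum-≡-suc x at-x off-x
  where
  at-x : bit (p x) ≡ suc (bit (without p x x))
  at-x rewrite px | dec-true (x ≟ x) refl = refl
  off-x : ∀ j → j ≢ x → bit (p j) ≡ bit (without p x j)
  off-x j j≢x rewrite dec-false (j ≟ x) j≢x = cong bit (sym (∧-identityʳ (p j)))

count-zero : ∀ {n} (p : Fin n → Bool) → (∀ i → p i ≡ false) → count p ≡ 0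
count-zero {n} p none = trans (sum-cong-≗ (λ i → cong bit (none i))) (sum-replicate-zero n)

length≤count : ∀ {n} {p : Fin n → Bool} {xs} → Unique xs → All (λ i → p i ≡ true) xs →
               length xs ≤ count p
length≤count [] [] = z≤n
length≤count {p = p} {x ∷ xs} (x∉xs ∷ unique) (px ∷ pxs) = begin
  suc (length xs)            ≤⟨ s≤s (length≤count unique (All.zipWith keep (x∉xs , pxs))) ⟩
  suc (count (without p x))  ≡⟨ sym (count-without p px) ⟩
  count p                    ∎
  where
  open ≤-Reasoning
  keep : ∀ {i} → x ≢ i × p i ≡ true → without p x i ≡ true
  keep {i} (x≢i , pi) rewrite dec-false (i ≟ x) (x≢i ∘ sym) | pi = refl

count-pos : ∀ {n} {p : Fin n → Bool} {i} → p i ≡ true → 0 < count p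
count-pos {p = p} pi = length≤count {p = p} ([] ∷ []) (pi ∷ [])

allFalse⊎any : ∀ {n} (p : Fin n → Bool) → (∀ i → p i ≡ false) ⊎ ∃ λ i → p i ≡ true
allFalse⊎any p with any? (λ i → p i Data.Bool.≟ true)
... | yes found = inj₂ found
... | no  none  = inj₁ λ i → ¬-not λ pi → none (i , pi)

count-pos⁻¹ : ∀ {n} (p : Fin n → Bool) → 0 < count p → ∃ λ i → p i ≡ true
count-pos⁻¹ p 0<count with allFalse⊎any p
... | inj₂ found = found
... | inj₁ none  = contradiction (count-zero p none) (>⇒≢ 0<count)

count-zero⁻¹ : ∀ {n} (p : Fin n → Bool) → count p ≡ 0 → ∀ i → p i ≡ false
count-zero⁻¹ p count≡0 i = ¬-not λ pi → >⇒≢ (count-pos {p = p} pi) count≡0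

count≤1 : ∀ {n} (p : Fin n → Bool) → (∀ {i j} → p i ≡ true → p j ≡ true → i ≡ j) → count p ≤ 1
count≤1 p atMostOne with allFalse⊎any p
... | inj₁ none      = ≤-trans (≤-reflexive (count-zero p none)) z≤n
... | inj₂ (x , px) = ≤-reflexive (trans (count-without p px) (cong suc (count-zero _ others)))
  where
  others : ∀ i → without p x i ≡ false
  others i with p i in pi | i ≟ x
  ... | false | _       = refl
  ... | true  | yes _   = refl
  ... | true  | no i≢x = contradiction (atMostOne pi px) i≢x

count≤1⇒unique : ∀ {n} {p : Fin n → Bool} → count p ≤ 1 →
                 ∀ {a b} → p a ≡ true → p b ≡ true → a ≡ b
count≤1⇒unique {p = p} c≤1 {a} {b} pa pb with a ≟ b
... | yes a≡b = a≡b
... | no  a≢b = contradiction (≤-trans two≤count c≤1) λ { (s≤s ()) }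
  where two≤count = length≤count {p = p} ((a≢b ∷ []) ∷ [] ∷ []) (pa ∷ pb ∷ [])

count≤2⇒¬three : ∀ {n} {p : Fin n → Bool} → count p ≤ 2 →
                 ∀ {a b c} → a ≢ b → a ≢ c → b ≢ c →
                 p a ≡ true → p b ≡ true → p c ≡ true → ⊥
count≤2⇒¬three {p = p} c≤2 a≢b a≢c b≢c pa pb pc =
  contradiction (≤-trans three≤count c≤2) λ { (s≤s (s≤s ())) }
  where
  three≤count = length≤count {p = p} ((a≢b ∷ a≢c ∷ []) ∷ (b≢c ∷ []) ∷ [] ∷ []) (pa ∷ pb ∷ pc ∷ [])

length-filterᵇ-tabulate : ∀ {A : Set} {n} (p : A → Bool) (f : Fin n → A) →
                          length (filterᵇ p (tabulate f)) ≡ count (p ∘ f)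
length-filterᵇ-tabulate {n = zero}  p f = refl
length-filterᵇ-tabulate {n = suc n} p f with p (f zero)
... | true  = cong suc (length-filterᵇ-tabulate p (f ∘ suc))
... | false = length-filterᵇ-tabulate p (f ∘ suc)

length-filterᵇ-map : ∀ {A B : Set} (p : B → Bool) (f : A → B) xs →
                     length (filterᵇ p (map f xs)) ≡ length (filterᵇ (p ∘ f) xs)
length-filterᵇ-map p f []       = refl
length-filterᵇ-map p f (x ∷ xs) with p (f x)
... | true  = cong suc (length-filterᵇ-map p f xs)
... | false = length-filterᵇ-map p f xs

length-filterᵇ-concatMap : ∀ {A B : Set} {n} (p : B → Bool) (g : A → List B) (f : Fin n → A) →
  length (filterᵇ p (concatMap g (tabulate f))) ≡ sum (λ i → length (filterᵇ p (g (f i))))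
length-filterᵇ-concatMap {n = zero}  p g f = refl
length-filterᵇ-concatMap {n = suc n} p g f = begin
  length (filterᵇ p (g (f zero) ++ concatMap g (tabulate (f ∘ suc))))
    ≡⟨ cong length (filter-++ _ (g (f zero)) _) ⟩
  length (filterᵇ p (g (f zero)) ++ filterᵇ p (concatMap g (tabulate (f ∘ suc))))
    ≡⟨ length-++ (filterᵇ p (g (f zero))) ⟩
  length (filterᵇ p (g (f zero))) + length (filterᵇ p (concatMap g (tabulate (f ∘ suc))))
    ≡⟨ cong (length (filterᵇ p (g (f zero))) +_) (length-filterᵇ-concatMap p g (f ∘ suc)) ⟩
  sum (λ i → length (filterᵇ p (g (f i)))) ∎
  where open ≡-Reasoning

unique-map-injective : ∀ {A B : Set} (f : A → B) {xs x y} → Unique (map f xs) →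
                       x ∈ xs → y ∈ xs → f x ≡ f y → x ≡ y
unique-map-injective f _            (here refl) (here refl) _ = refl
unique-map-injective f (fx∉ ∷ _)    (here refl) (there y∈)  fx≡fy =
  contradiction fx≡fy (All.lookup fx∉ (∈-map⁺ f y∈))
unique-map-injective f (fy∉ ∷ _)    (there x∈)  (here refl) fx≡fy =
  contradiction (sym fx≡fy) (All.lookup fy∉ (∈-map⁺ f x∈))
unique-map-injective f (_ ∷ unique) (there x∈)  (there y∈)  fx≡fy =
  unique-map-injective f unique x∈ y∈ fx≡fy

∈-map-proj₁⁻ : ∀ {A B : Set} {L : List (A × B)} {a} → a ∈ map proj₁ L → ∃ λ b → (a , b) ∈ L
∈-map-proj₁⁻ a∈ with ∈-map⁻ proj₁ a∈
... | (_ , b) , ab∈ , refl = b , ab∈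

module _ (G : HRLQ) where
  open HRLQ G

  _⊆_ : EdgeSet G → EdgeSet G → Set
  M₀ ⊆ M = ∀ {r h} → M₀ r h ≡ true → M r h ≡ true

  edgeCount : EdgeSet G → ℕ
  edgeCount M = sum (λ r → count (M r))

  load≡count : ∀ M h → load G M h ≡ count (λ r → M r h)
  load≡count M h = length-filterᵇ-tabulate (λ r → M r h) id

  size≡edgeCount : ∀ M → size G M ≡ edgeCount M
  size≡edgeCount M =
    trans (length-filterᵇ-concatMap {n = nR} inM (λ r → map (r ,_) (allFin nH)) id) (sum-cong-≗ λ r →
      trans (length-filterᵇ-map inM (r ,_) (allFin nH)) (length-filterᵇ-tabulate (M r) id))
    where
    inM : Fin nR × Fin nH → Bool
    inM (r , h) = M r h

  record IsOneToOne (M : EdgeSet G) : Set where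
    field
      hospital-unique : ∀ {r h h′} → M r h ≡ true → M r h′ ≡ true → h ≡ h′
      resident-unique : ∀ {r r′ h} → M r h ≡ true → M r′ h ≡ true → r ≡ r′

  oneToOne-⊆ : ∀ {M₀ M} → M₀ ⊆ M → IsOneToOne M → IsOneToOne M₀
  oneToOne-⊆ M₀⊆M M-1:1 = record
    { hospital-unique = λ m m′ → hospital-unique (M₀⊆M m) (M₀⊆M m′)
    ; resident-unique = λ m m′ → resident-unique (M₀⊆M m) (M₀⊆M m′)
    }
    where open IsOneToOne M-1:1

  matched⇒quota-pos : ∀ {M r h} → IsMatching G M → M r h ≡ true → 0 < qup h
  matched⇒quota-pos {M} {h = h} M-matching m =
    ≤-trans (count-pos {p = λ r → M r h} m)
            (subst (_≤ qup h) (load≡count M h) (IsMatching.quota M-matching h))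

  removeEdge : EdgeSet G → Fin nR → Fin nH → EdgeSet G
  removeEdge M a b r h = M r h ∧ not (does (r ≟ a) ∧ does (h ≟ b))

  removeEdge-⊆ : ∀ M a b → removeEdge M a b ⊆ M
  removeEdge-⊆ M a b {r} {h} m with M r h
  ... | true = refl

  removeEdge-self : ∀ M a b → removeEdge M a b a b ≡ false
  removeEdge-self M a b rewrite dec-true (a ≟ a) refl | dec-true (b ≟ b) refl = ∧-zeroʳ (M a b)

  removeEdge-≢ʳ : ∀ M a b {r} h → r ≢ a → removeEdge M a b r h ≡ M r h
  removeEdge-≢ʳ M a b {r} h r≢a rewrite dec-false (r ≟ a) r≢a = ∧-identityʳ (M r h)

  removeEdge-≢ʰ : ∀ M a b r {h} → h ≢ b → removeEdge M a b r h ≡ M r h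
  removeEdge-≢ʰ M a b r {h} h≢b rewrite dec-false (h ≟ b) h≢b | ∧-zeroʳ (does (r ≟ a)) =
    ∧-identityʳ (M r h)

  edgeCount-removeEdge : ∀ M {a b} → M a b ≡ true → edgeCount M ≡ suc (edgeCount (removeEdge M a b))
  edgeCount-removeEdge M {a} {b} mab = sum-≡-suc a row-a other-rows
    where
    row-a : count (M a) ≡ suc (count (removeEdge M a b a))
    row-a rewrite dec-true (a ≟ a) refl = count-without (M a) mab
    other-rows : ∀ r → r ≢ a → count (M r) ≡ count (removeEdge M a b r)
    other-rows r r≢a = sum-cong-≗ λ h → cong bit (sym (removeEdge-≢ʳ M a b h r≢a))

  data AlternatingFrom (M M* : EdgeSet G) : Fin nH → Path G → Set where
    stop : ∀ {h} → (∀ r → M r h ≡ false) → AlternatingFrom M M* h []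
    link : ∀ {h r h′ T} → M r h ≡ true → M* r h′ ≡ true → AlternatingFrom M M* h′ T →
           AlternatingFrom M M* h ((r , h′) ∷ T)

  alternating-M* : ∀ {M M* h T} → AlternatingFrom M M* h T → All (λ (r , h′) → M* r h′ ≡ true) T
  alternating-M* (stop _)         = []
  alternating-M* (link _ m* alt) = m* ∷ alternating-M* alt

  alternating-transfer : ∀ {M₀ M*₀ M M*} → M*₀ ⊆ M* →
    (∀ {y h} → M*₀ y h ≡ true → ∀ r → M₀ r h ≡ M r h) →
    ∀ {y h T} → M*₀ y h ≡ true → AlternatingFrom M₀ M*₀ h T → AlternatingFrom M M* h T
  alternating-transfer M*₀⊆M* agree yh (stop free)     = stop λ r → trans (sym (agree yh r)) (free r)
  alternating-transfer M*₀⊆M* agree yh (link m m* alt) =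
    link (trans (sym (agree yh _)) m) (M*₀⊆M* m*) (alternating-transfer M*₀⊆M* agree m* alt)

  record AlternatingWalk (M M* : EdgeSet G) : Set where
    constructor walk
    field
      start              : Fin nR
      first              : Fin nH
      rest               : Path G
      start-free         : ∀ h → M start h ≡ false
      start-M*           : M* start first ≡ true
      alternating        : AlternatingFrom M M* first rest
      distinct-residents : Unique (map proj₁ ((start , first) ∷ rest))
      distinct-hospitals : Unique (map proj₂ ((start , first) ∷ rest))

    edges-M* : All (λ (r , h) → M* r h ≡ true) ((start , first) ∷ rest)
    edges-M* = start-M* ∷ alternating-M* alternating

  deficient-resident : ∀ {M M*} → IsOneToOne M* → edgeCount M < edgeCount M* →
                       ∃ λ r → (∀ h → M r h ≡ false) × ∃ λ h → M* r h ≡ true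
  deficient-resident {M} {M*} M*-1:1 ec< =
    let r , fewer = sum-<⇒∃< (λ r → count (M r)) (λ r → count (M* r)) ec<
        atMostOne = count≤1 (M* r) (IsOneToOne.hospital-unique M*-1:1)
    in r , count-zero⁻¹ (M r) (n<1⇒n≡0 (<-≤-trans fewer atMostOne))
         , count-pos⁻¹ (M* r) (≤-<-trans z≤n fewer)

  -- Deleting r₁h₁ from M* and r₂h₁ from M keeps |M| < |M*|. A walk for the smaller pair that
  -- starts at r₂ is extended by (r₁ , h₁); any other one is already a walk for M and M*.
  extend-walk : ∀ {M M* r₁ h₁ r₂} → IsOneToOne M* →
    (∀ h → M r₁ h ≡ false) → M* r₁ h₁ ≡ true → M r₂ h₁ ≡ true →
    AlternatingWalk (removeEdge M r₂ h₁) (removeEdge M* r₁ h₁) → AlternatingWalk M M*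
  extend-walk {M} {M*} {r₁} {h₁} {r₂} M*-1:1 r₁-free r₁h₁ r₂h₁ W₀ = extend (start ≟ r₂)
    where
    open AlternatingWalk W₀
    open IsOneToOne M*-1:1
    M*₀ = removeEdge M* r₁ h₁
    M*₀⊆M* = removeEdge-⊆ M* r₁ h₁

    r₁-unmatched₀ : ∀ {h} → M*₀ r₁ h ≡ true → ⊥
    r₁-unmatched₀ m*₀ with hospital-unique r₁h₁ (M*₀⊆M* m*₀)
    ... | refl = ≡true⇒≢false m*₀ (removeEdge-self M* r₁ h₁)

    h₁-unmatched₀ : ∀ {r} → M*₀ r h₁ ≡ true → ⊥
    h₁-unmatched₀ m*₀ with resident-unique r₁h₁ (M*₀⊆M* m*₀)
    ... | refl = ≡true⇒≢false m*₀ (removeEdge-self M* r₁ h₁)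

    alternating′ : AlternatingFrom M M* first rest
    alternating′ = alternating-transfer M*₀⊆M*
      (λ yh r → removeEdge-≢ʰ M r₂ h₁ r λ { refl → h₁-unmatched₀ yh }) start-M* alternating

    r₁-new : All (r₁ ≢_) (map proj₁ ((start , first) ∷ rest))
    r₁-new = Allₚ.map⁺ (All.map (λ { m*₀ refl → r₁-unmatched₀ m*₀ }) edges-M*)

    h₁-new : All (h₁ ≢_) (map proj₂ ((start , first) ∷ rest))
    h₁-new = Allₚ.map⁺ (All.map (λ { m*₀ refl → h₁-unmatched₀ m*₀ }) edges-M*)

    extend : Dec (start ≡ r₂) → AlternatingWalk M M*
    extend (yes start≡r₂) =
      walk r₁ h₁ ((start , first) ∷ rest) r₁-free r₁h₁
           (link (subst (λ s → M s h₁ ≡ true) (sym start≡r₂) r₂h₁) (M*₀⊆M* start-M*) alternating′)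
           (r₁-new ∷ distinct-residents) (h₁-new ∷ distinct-hospitals)
    extend (no start≢r₂) =
      walk start first rest (λ h → trans (sym (removeEdge-≢ʳ M r₂ h₁ h start≢r₂)) (start-free h))
           (M*₀⊆M* start-M*) alternating′ distinct-residents distinct-hospitals

  alternatingWalk : ∀ {M M*} → IsOneToOne M → IsOneToOne M* → edgeCount M < edgeCount M* →
                    AlternatingWalk M M*
  alternatingWalk {M* = M*} = bounded (edgeCount M*) ≤-refl
    where
    bounded : ∀ n {M M*} → edgeCount M* ≤ n → IsOneToOne M → IsOneToOne M* →
              edgeCount M < edgeCount M* → AlternatingWalk M M*
    bounded zero    M*≤0 _ _ ec< = contradiction (<-≤-trans ec< M*≤0) λ ()
    bounded (suc n) {M} {M*} M*≤ M-1:1 M*-1:1 ec<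
      with deficient-resident M*-1:1 ec<
    ... | r₁ , r₁-free , h₁ , r₁h₁ with allFalse⊎any (λ r → M r h₁)
    ...   | inj₁ h₁-free = walk r₁ h₁ [] r₁-free r₁h₁ (stop h₁-free) ([] ∷ []) ([] ∷ [])
    ...   | inj₂ (r₂ , r₂h₁) = extend-walk M*-1:1 r₁-free r₁h₁ r₂h₁
              (bounded n (s≤s⁻¹ (subst (_≤ suc n) ec*≡ M*≤))
                         (oneToOne-⊆ (removeEdge-⊆ M r₂ h₁) M-1:1)
                         (oneToOne-⊆ (removeEdge-⊆ M* r₁ h₁) M*-1:1)
                         (s≤s⁻¹ (subst₂ _<_ ec≡ ec*≡ ec<)))
      where
      ec≡  = edgeCount-removeEdge M r₂h₁
      ec*≡ = edgeCount-removeEdge M* r₁h₁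

  module _ {M M* : EdgeSet G} where

    alternating⇒linked : ∀ x {k T} → AlternatingFrom M M* k T → Linked G M ((x , k) ∷ T)
    alternating⇒linked x (stop _)       = tt
    alternating⇒linked x (link m _ alt) = m , alternating⇒linked _ alt

    alternating⇒endsUnder : ∀ x {k T} → IsMatching G M* → 0 < qup k → AlternatingFrom M M* k T →
                            EndsUnder G M ((x , k) ∷ T)
    alternating⇒endsUnder x {k} _ 0<qup (stop free) =
      subst (_< qup k) (sym (trans (load≡count M k) (count-zero _ free))) 0<qup
    alternating⇒endsUnder x M*-matching _ (link _ m* alt) =
      alternating⇒endsUnder _ M*-matching (matched⇒quota-pos M*-matching m*) alt

    alternating-newEdges : ∀ {k T} → IsOneToOne M → IsMatching G M* → AlternatingFrom M M* k T →
                           Unique (k ∷ map proj₂ T) → All (λ (r , h) → E r h ≡ true × M r h ≡ false) T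
    alternating-newEdges _     _           (stop _)            _                        = []
    alternating-newEdges M-1:1 M*-matching (link {r = r} {h′} m m* alt) ((k≢h′ ∷ _) ∷ distinct) =
      (IsMatching.⊆E M*-matching r h′ m* , ¬-not (k≢h′ ∘ IsOneToOne.hospital-unique M-1:1 m))
      ∷ alternating-newEdges M-1:1 M*-matching alt distinct

    alternating-residents-matched : ∀ {k T} → AlternatingFrom M M* k T →
                                    All (λ r → ∃ λ h → M r h ≡ true) (map proj₁ T)
    alternating-residents-matched (stop _)       = []
    alternating-residents-matched (link m _ alt) = (_ , m) ∷ alternating-residents-matched alt

    alternating⇒augmenting : ∀ {x k T} → IsOneToOne M → IsMatching G M* → 0 < qup k →
      (∀ h → M x h ≡ false) → E x k ≡ true → AlternatingFrom M M* k T →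
      Unique (map proj₁ T) → Unique (k ∷ map proj₂ T) → IsAugmentingPath G M ((x , k) ∷ T)
    alternating⇒augmenting {x} {k} M-1:1 M*-matching 0<qup x-free xk alt distinct-res distinct-hosp = record
      { distinctRes      = All.map (λ { (h , m) refl → ≡true⇒≢false m (x-free h) })
                                   (alternating-residents-matched alt) ∷ distinct-res
      ; distinctHosp     = distinct-hosp
      ; nonMatchingEdges = (xk , x-free k) ∷ alternating-newEdges M-1:1 M*-matching alt distinct-hosp
      ; matchingEdges    = alternating⇒linked x alt
      ; start            = x-free
      ; end              = alternating⇒endsUnder x M*-matching 0<qup alt
      }

  matchesEdge : Fin nR → Fin nH → Fin nR × Fin nH → Bool
  matchesEdge r h e = ⌊ proj₁ e ≟ r ⌋ ∧ ⌊ proj₂ e ≟ h ⌋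

  linkEdges : Path G → List (Fin nR × Fin nH)
  linkEdges []                        = []
  linkEdges (_ ∷ [])                  = []
  linkEdges ((_ , h) ∷ (r′ , h′) ∷ P) = (r′ , h) ∷ linkEdges ((r′ , h′) ∷ P)

  ∈-pathEdges⁻ : ∀ P {e} → e ∈ pathEdges G P → e ∈ P ⊎ e ∈ linkEdges P
  ∈-pathEdges⁻ (_ ∷ [])     (here refl)         = inj₁ (here refl)
  ∈-pathEdges⁻ (_ ∷ _ ∷ _)  (here refl)         = inj₁ (here refl)
  ∈-pathEdges⁻ (_ ∷ _ ∷ _)  (there (here refl)) = inj₂ (here refl)
  ∈-pathEdges⁻ (_ ∷ p ∷ P)  (there (there e∈)) with ∈-pathEdges⁻ (p ∷ P) e∈
  ... | inj₁ e∈P    = inj₁ (there e∈P)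
  ... | inj₂ e∈link = inj₂ (there e∈link)

  ∈-pathEdges⁺ˡ : ∀ P {e} → e ∈ P → e ∈ pathEdges G P
  ∈-pathEdges⁺ˡ (_ ∷ [])    (here refl) = here refl
  ∈-pathEdges⁺ˡ (_ ∷ _ ∷ _) (here refl) = here refl
  ∈-pathEdges⁺ˡ (_ ∷ p ∷ P) (there e∈) = there (there (∈-pathEdges⁺ˡ (p ∷ P) e∈))

  ∈-pathEdges⁺ʳ : ∀ P {e} → e ∈ linkEdges P → e ∈ pathEdges G P
  ∈-pathEdges⁺ʳ (_ ∷ _ ∷ _) (here refl) = there (here refl)
  ∈-pathEdges⁺ʳ (_ ∷ p ∷ P) (there e∈) = there (there (∈-pathEdges⁺ʳ (p ∷ P) e∈))

  linked⇒linkEdges-matched : ∀ {M} P → Linked G M P → All (λ (r , h) → M r h ≡ true) (linkEdges P)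
  linked⇒linkEdges-matched []          _              = []
  linked⇒linkEdges-matched (_ ∷ [])    _              = []
  linked⇒linkEdges-matched (_ ∷ p ∷ P) (m , linked) = m ∷ linked⇒linkEdges-matched (p ∷ P) linked

  linkEdges⇒residents : ∀ e P {r h} → (r , h) ∈ linkEdges (e ∷ P) → r ∈ map proj₁ P
  linkEdges⇒residents _ (_ ∷ P) (here refl) = here refl
  linkEdges⇒residents _ (p ∷ P) (there e∈) = there (linkEdges⇒residents p P e∈)

  residents⇒linkEdges : ∀ e P {r} → r ∈ map proj₁ P → ∃ λ h → (r , h) ∈ linkEdges (e ∷ P)
  residents⇒linkEdges (_ , h) (_ ∷ P) (here refl) = h , here refl
  residents⇒linkEdges _       (p ∷ P) (there r∈) with residents⇒linkEdges p P r∈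
  ... | h , r∈link = h , there r∈link

  inPath⇒∈ : ∀ P {r h} → inPath G P r h ≡ true → (r , h) ∈ pathEdges G P
  inPath⇒∈ P {r} {h} inP = Any.map sameEdge (any⁻ (matchesEdge r h) (pathEdges G P) (Equivalence.from T-≡ inP))
    where
    sameEdge : ∀ {e} → T (matchesEdge r h e) → (r , h) ≡ e
    sameEdge {a , b} t = let a≡r , b≡h = Equivalence.to (T-∧ {⌊ a ≟ r ⌋}) t in
      sym (cong₂ _,_ (toWitness {a? = a ≟ r} a≡r) (toWitness {a? = b ≟ h} b≡h))

  ∈⇒inPath : ∀ P {r h} → (r , h) ∈ pathEdges G P → inPath G P r h ≡ true
  ∈⇒inPath P {r} {h} e∈ = Equivalence.to T-≡ (any⁺ (matchesEdge r h) (Any.map sameEdge e∈))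
    where
    sameEdge : ∀ {e} → (r , h) ≡ e → T (matchesEdge r h e)
    sameEdge refl =
      Equivalence.from (T-∧ {⌊ r ≟ r ⌋}) (fromWitness {a? = r ≟ r} refl , fromWitness {a? = h ≟ h} refl)

  matched-resident⇒linkEdge : ∀ {M} P {r h} → IsMatching G M → IsAugmentingPath G M P →
                              r ∈ map proj₁ P → M r h ≡ true → (r , h) ∈ linkEdges P
  matched-resident⇒linkEdge ((x , k) ∷ T) {h = h} _ aug (here refl) m =
    ⊥-elim (≡true⇒≢false m (IsAugmentingPath.start aug h))
  matched-resident⇒linkEdge ((x , k) ∷ T) {r} M-matching aug (there r∈T) m
    with residents⇒linkEdges (x , k) T r∈T
  ... | p , rp∈ =
    subst (λ h → (r , h) ∈ linkEdges ((x , k) ∷ T)) (IsMatching.resOne M-matching r p _ mp m) rp∈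
    where
    mp = All.lookup (linked⇒linkEdges-matched _ (IsAugmentingPath.matchingEdges aug)) rp∈

  AugmentedEdge : EdgeSet G → Path G → Fin nR → Fin nH → Set
  AugmentedEdge M P r h = (r , h) ∈ P ⊎ (M r h ≡ true × r ∉ map proj₁ P)

  ⊕-edge⁻ : ∀ {M} P {r h} → IsMatching G M → IsAugmentingPath G M P → _⊕_ G M P r h ≡ true →
            AugmentedEdge M P r h
  ⊕-edge⁻ {M} P {r} {h} M-matching aug m⊕ with M r h in m | inPath G P r h in inP
  ⊕-edge⁻ P _ _ () | true  | true
  ⊕-edge⁻ P _ _ () | false | false
  ... | false | true with ∈-pathEdges⁻ P (inPath⇒∈ P inP)
  ...   | inj₁ new  = inj₁ new
  ...   | inj₂ e∈link = ⊥-elim (≡true⇒≢false (All.lookup linkEdges-matched e∈link) m)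
    where linkEdges-matched = linked⇒linkEdges-matched P (IsAugmentingPath.matchingEdges aug)
  ⊕-edge⁻ {M} P {r} {h} M-matching aug m⊕ | true | false = inj₂ (refl , r∉)
    where
    r∉ : r ∉ map proj₁ P
    r∉ r∈ = ≡true⇒≢false (∈⇒inPath P (∈-pathEdges⁺ʳ P rh-link)) inP
      where rh-link = matched-resident⇒linkEdge P M-matching aug r∈ m

  ⊕-edge⁺ˡ : ∀ {M} P {r h} → IsAugmentingPath G M P → (r , h) ∈ P → _⊕_ G M P r h ≡ true
  ⊕-edge⁺ˡ P aug e∈ rewrite proj₂ (All.lookup (IsAugmentingPath.nonMatchingEdges aug) e∈)
                          | ∈⇒inPath P (∈-pathEdges⁺ˡ P e∈) = refl

  ⊕-edge⁺ʳ : ∀ {M} P {r h} → M r h ≡ true → r ∉ map proj₁ P → _⊕_ G M P r h ≡ true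
  ⊕-edge⁺ʳ P {r} {h} m r∉ with inPath G P r h in inP
  ... | false rewrite m = refl
  ... | true with P | ∈-pathEdges⁻ P (inPath⇒∈ P inP)
  ...   | _ | inj₁ new = contradiction (∈-map⁺ proj₁ new) r∉
  ...   | e ∷ T | inj₂ e∈link = contradiction (there (linkEdges⇒residents e T e∈link)) r∉

  path-quota-pos : ∀ {M} P → IsMatching G M → Linked G M P → EndsUnder G M P →
                   ∀ {r h} → (r , h) ∈ P → 0 < qup h
  path-quota-pos (_ ∷ [])    _          _        under (here refl) = ≤-<-trans z≤n under
  path-quota-pos (_ ∷ _ ∷ _) M-matching (m , _)  _     (here refl) = matched⇒quota-pos M-matching m
  path-quota-pos (_ ∷ p ∷ P) M-matching (_ , linked) under (there e∈) =
    path-quota-pos (p ∷ P) M-matching linked under e∈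

  module _ (unitQuota : ∀ h → qup h ≤ 1) where

    matching⇒oneToOne : ∀ {M} → IsMatching G M → IsOneToOne M
    matching⇒oneToOne {M} M-matching = record
      { hospital-unique = λ {r} {h} {h′} → IsMatching.resOne M-matching r h h′
      ; resident-unique = λ {h = h} → count≤1⇒unique (load≤1 h)
      }
      where
      load≤1 : ∀ h → count (λ r → M r h) ≤ 1
      load≤1 h = subst (_≤ 1) (load≡count M h) (≤-trans (IsMatching.quota M-matching h) (unitQuota h))

    path-hospital-partner : ∀ {M} → IsOneToOne M → ∀ P → Linked G M P → EndsUnder G M P →
                            ∀ {r h b} → (r , h) ∈ P → M b h ≡ true → b ∈ map proj₁ P
    path-hospital-partner {M} _ (_ ∷ []) _ under {h = h} (here refl) mb =
      contradiction (<-≤-trans (subst (_< qup h) (load≡count M h) under) (unitQuota h))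
                    (≤⇒≯ (count-pos {p = λ r → M r h} mb))
    path-hospital-partner M-1:1 (_ ∷ _ ∷ _) (m , _) _ (here refl) mb =
      there (here (IsOneToOne.resident-unique M-1:1 mb m))
    path-hospital-partner M-1:1 (_ ∷ p ∷ P) (_ , linked) under (there e∈) mb =
      there (path-hospital-partner M-1:1 (p ∷ P) linked under e∈ mb)

    augment-isMatching : ∀ {M} P → IsMatching G M → IsAugmentingPath G M P → IsMatching G (_⊕_ G M P)
    augment-isMatching {M} P M-matching aug = record
      { ⊆E     = λ r h m⊕ → ⊆E (⊕-edge⁻ P M-matching aug m⊕)
      ; resOne = λ r h h′ a b → hospital-unique (⊕-edge⁻ P M-matching aug a) (⊕-edge⁻ P M-matching aug b)
      ; quota  = quota
      }
      where
      open IsAugmentingPath aug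
      M-1:1 = matching⇒oneToOne M-matching
      M′ = _⊕_ G M P
      partner = path-hospital-partner M-1:1 P matchingEdges end

      ⊆E : ∀ {r h} → AugmentedEdge M P r h → E r h ≡ true
      ⊆E (inj₁ new)     = proj₁ (All.lookup nonMatchingEdges new)
      ⊆E (inj₂ (m , _)) = IsMatching.⊆E M-matching _ _ m

      hospital-unique : ∀ {r h h′} → AugmentedEdge M P r h →
                        AugmentedEdge M P r h′ → h ≡ h′
      hospital-unique (inj₁ new)      (inj₁ new′)     =
        cong proj₂ (unique-map-injective proj₁ distinctRes new new′ refl)
      hospital-unique (inj₁ new)      (inj₂ (_ , r∉)) = contradiction (∈-map⁺ proj₁ new) r∉
      hospital-unique (inj₂ (_ , r∉)) (inj₁ new′)     = contradiction (∈-map⁺ proj₁ new′) r∉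
      hospital-unique (inj₂ (m , _))  (inj₂ (m′ , _)) = IsOneToOne.hospital-unique M-1:1 m m′

      resident-unique : ∀ {a b h} → M′ a h ≡ true → M′ b h ≡ true → a ≡ b
      resident-unique a⊕ b⊕ with ⊕-edge⁻ P M-matching aug a⊕ | ⊕-edge⁻ P M-matching aug b⊕
      ... | inj₁ new      | inj₁ new′      =
        cong proj₁ (unique-map-injective proj₂ distinctHosp new new′ refl)
      ... | inj₁ new      | inj₂ (mb , b∉) = contradiction (partner new mb) b∉
      ... | inj₂ (ma , a∉) | inj₁ new′     = contradiction (partner new′ ma) a∉
      ... | inj₂ (ma , _) | inj₂ (mb , _)  = IsOneToOne.resident-unique M-1:1 ma mb

      quota : ∀ h → load G M′ h ≤ qup h
      quota h rewrite load≡count M′ h with allFalse⊎any (λ r → M′ r h)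
      ... | inj₁ none     = ≤-trans (≤-reflexive (count-zero _ none)) z≤n
      ... | inj₂ (r , r⊕) =
        ≤-trans (count≤1 (λ r → M′ r h) resident-unique) (quota-pos (⊕-edge⁻ P M-matching aug r⊕))
        where
        quota-pos : ∀ {r h} → AugmentedEdge M P r h → 0 < qup h
        quota-pos (inj₁ new)     = path-quota-pos P M-matching matchingEdges end new
        quota-pos (inj₂ (m , _)) = matched⇒quota-pos M-matching m

  Rival : EdgeSet G → Fin nH → Fin nR → Fin nR → Set
  Rival M h r y = E y h ≡ true × rankH h y < rankH h r × PrefersToCurrent G M y h

  Unrivalled : EdgeSet G → Fin nR → Fin nH → Set
  Unrivalled M r h = ∀ y → ¬ Rival M h r y

  rival? : ∀ M h r y → Dec (Rival M h r y)
  rival? M h r y = (E y h Data.Bool.≟ true) ×-dec (rankH h y <? rankH h r) ×-dec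
                   Finₚ.all? (λ h′ → (M y h′ Data.Bool.≟ true) →-dec (rankR y h <? rankR y h′))

  unrivalled-or-bestRival : ∀ M h r → Unrivalled M r h ⊎ ∃ λ x → Rival M h r x × Unrivalled M x h
  unrivalled-or-bestRival M h r with any? (rival? M h r)
  ... | no  none             = inj₁ λ y y-rival → none (y , y-rival)
  ... | yes (y , y-rival) = inj₂ (best y y-rival (<-wellFounded (rankH h y)))
    where
    best : ∀ y → Rival M h r y → Acc _<_ (rankH h y) → ∃ λ x → Rival M h r x × Unrivalled M x h
    best y y-rival (acc smaller) with any? (rival? M h y)
    ... | no  none                          = y , y-rival , λ z z-rival → none (z , z-rival)
    ... | yes (z , z-rival@(Ez , z<y , zpref)) =
      best z (Ez , <-trans z<y (proj₁ (proj₂ y-rival)) , zpref) (smaller z<y)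

  module _ (degree≤2 : ∀ r → prefLength G r ≤ 2) where

    ¬three-neighbours : ∀ {r a b c} → a ≢ b → a ≢ c → b ≢ c →
                        E r a ≡ true → E r b ≡ true → E r c ≡ true → ⊥
    ¬three-neighbours {r} = count≤2⇒¬three (subst (_≤ 2) (length-filterᵇ-tabulate (E r) id) (degree≤2 r))

    -- An M-hospital h′ of x would, together with h, exhaust x's two acceptable hospitals, so x
    -- would prefer h to its M*-hospital and envy s in M*.
    rival⇒unmatched : ∀ {M M* s h x} → IsMatching G M → IsMatching G M* → IsOneToOne M* →
                      EnvyFree G M* → M* s h ≡ true → Rival M h s x → ∀ h′ → M x h′ ≡ false
    rival⇒unmatched {M} {M*} {s} {h} {x} M-matching M*-matching M*-1:1 M*-envyFree sh
                    (Exh , x<s , prefers) h′ =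
      ¬-not λ xh′ → M*-envyFree x s (h , sh , Exh , prefers* xh′ , x<s)
      where
      prefers* : M x h′ ≡ true → PrefersToCurrent G M* x h
      prefers* xh′ h″ xh″ with h″ ≟ h′ | h″ ≟ h
      ... | yes refl | _        = prefers h″ xh′
      ... | no _     | yes refl =
        contradiction (cong (rankH h) (IsOneToOne.resident-unique M*-1:1 xh″ sh)) (<⇒≢ x<s)
      ... | no h″≢h′ | no h″≢h  = ⊥-elim (¬three-neighbours
        (λ { refl → <-irrefl refl (prefers h′ xh′) }) (h″≢h ∘ sym) (h″≢h′ ∘ sym)
        Exh (IsMatching.⊆E M-matching x h′ xh′) (IsMatching.⊆E M*-matching x h″ xh″))

  NoWorseThanPartner : EdgeSet G → Fin nR → Fin nH → Set
  NoWorseThanPartner M* r h = ∃ λ z → M* z h ≡ true × rankH h r ≤ rankH h z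

  EnvyFreeAugmentingPath : EdgeSet G → Set
  EnvyFreeAugmentingPath M =
    Σ (Path G) λ P → IsAugmentingPath G M P × IsMatching G (_⊕_ G M P) × EnvyFree G (_⊕_ G M P)

  module Repair (unitQuota : ∀ h → qup h ≤ 1) (degree≤2 : ∀ r → prefLength G r ≤ 2)
                {M M* : EdgeSet G} (M-matching : IsMatching G M) (M-envyFree : EnvyFree G M)
                (M*-matching : IsMatching G M*) (M*-envyFree : EnvyFree G M*) where

    open import Data.List.Membership.DecPropositional (_≟_ {nR}) using (_∈?_)

    M-1:1  = matching⇒oneToOne unitQuota M-matching
    M*-1:1 = matching⇒oneToOne unitQuota M*-matching

    -- A resident y on the path who envies o at h would envy h's M*-partner in M* if o is new at h,
    -- and would have three acceptable hospitals if o kept h. A resident off the path kept its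
    -- M-hospital, so o is either new at h, hence unrivalled, or y already envied o in M.
    augment-envyFree : ∀ {x k T} → IsAugmentingPath G M ((x , k) ∷ T) →
      All (λ (r , h) → M* r h ≡ true) T → NoWorseThanPartner M* x k →
      All (λ (r , h) → Unrivalled M r h) ((x , k) ∷ T) → EnvyFree G (_⊕_ G M ((x , k) ∷ T))
    augment-envyFree {x} {k} {T} aug T-M* x-noWorse unrivalled y o (h , oh , yh , prefers , y<o) =
      envy (y ∈? map proj₁ T) (⊕-edge⁻ P M-matching aug oh)
      where
      open IsAugmentingPath aug
      P = (x , k) ∷ T

      noWorse : All (λ (r , h) → NoWorseThanPartner M* r h) P
      noWorse = x-noWorse ∷ All.map (λ m* → _ , m* , ≤-refl) T-M*

      prefersM : y ∉ map proj₁ T → PrefersToCurrent G M y h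
      prefersM y∉T h′ yh′ = prefers h′ (⊕-edge⁺ʳ {M} P yh′ λ
        { (here refl)  → ≡true⇒≢false yh′ (start h′)
        ; (there y∈T) → y∉T y∈T })

      envy : Dec (y ∈ map proj₁ T) → AugmentedEdge M P o h → ⊥
      envy (no y∉T) (inj₁ oh∈P)       = All.lookup unrivalled oh∈P y (yh , y<o , prefersM y∉T)
      envy (no y∉T) (inj₂ (oh-M , _)) = M-envyFree y o (h , oh-M , yh , prefersM y∉T , y<o)
      envy (yes y∈T) o-edge with ∈-map-proj₁⁻ y∈T
      ... | k′ , yk′∈T with o-edge
      ...   | inj₁ oh∈P =
        let z , zh , o≤z = All.lookup noWorse oh∈P
        in M*-envyFree y z (h , zh , yh , prefers* , <-≤-trans y<o o≤z)
        where
        prefers* : PrefersToCurrent G M* y h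
        prefers* h″ yh″ = subst (λ h″ → rankR y h < rankR y h″)
          (IsOneToOne.hospital-unique M*-1:1 (All.lookup T-M* yk′∈T) yh″)
          (prefers k′ (⊕-edge⁺ˡ P aug (there yk′∈T)))
      ...   | inj₂ (oh-M , o∉P) =
        ¬three-neighbours degree≤2 h≢p h≢k′ p≢k′ yh (IsMatching.⊆E M-matching y p yp) (proj₁ yk′-new)
        where
        p-link = residents⇒linkEdges (x , k) T y∈T
        p = proj₁ p-link
        yp : M y p ≡ true
        yp = All.lookup (linked⇒linkEdges-matched P matchingEdges) (proj₂ p-link)
        yk′-new = All.lookup nonMatchingEdges (there yk′∈T)
        h≢p : h ≢ p
        h≢p refl = o∉P (there (subst (_∈ map proj₁ T) (sym (IsOneToOne.resident-unique M-1:1 oh-M yp)) y∈T))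
        h≢k′ : h ≢ k′
        h≢k′ refl = <-irrefl refl (prefers k′ (⊕-edge⁺ˡ P aug (there yk′∈T)))
        p≢k′ : p ≢ k′
        p≢k′ refl = ≡true⇒≢false yp (proj₂ yk′-new)

    record Claimant (k : Fin nH) (s : Fin nR) : Set where
      constructor claimant
      field
        resident   : Fin nR
        unmatched  : ∀ h → M resident h ≡ false
        acceptable : E resident k ≡ true
        noWorse    : rankH k resident ≤ rankH k s
        unrivalled : Unrivalled M resident k

    unrivalled-or-claimant : ∀ {s k} → M* s k ≡ true → Unrivalled M s k ⊎ Claimant k s
    unrivalled-or-claimant {s} {k} sk with unrivalled-or-bestRival M k s
    ... | inj₁ s-unrivalled = inj₁ s-unrivalled
    ... | inj₂ (x , x-rival@(xk , x<s , _) , x-unrivalled) =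
      inj₂ (claimant x x-unmatched xk (<⇒≤ x<s) x-unrivalled)
      where x-unmatched = rival⇒unmatched degree≤2 M-matching M*-matching M*-1:1 M*-envyFree sk x-rival

    augment-at-claimant : ∀ {s k T} → M* s k ≡ true → AlternatingFrom M M* k T →
                          Unique (map proj₁ T) → Unique (k ∷ map proj₂ T) →
                          All (λ (r , h) → Unrivalled M r h) T → Claimant k s → EnvyFreeAugmentingPath M
    augment-at-claimant {s} {k} {T} sk alt distinct-res distinct-hosp T-unrivalled
                        (claimant x x-free xk x≤s x-unrivalled) =
      P , aug , augment-isMatching unitQuota P M-matching aug ,
      augment-envyFree aug (alternating-M* alt) (s , sk , x≤s) (x-unrivalled ∷ T-unrivalled)
      where
      P = (x , k) ∷ T
      aug = alternating⇒augmenting M-1:1 M*-matching (matched⇒quota-pos M*-matching sk)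
                                   x-free xk alt distinct-res distinct-hosp

    augmentation-or-unrivalled : ∀ {k T} → AlternatingFrom M M* k T →
                                 Unique (map proj₁ T) → Unique (k ∷ map proj₂ T) →
                                 EnvyFreeAugmentingPath M ⊎ All (λ (r , h) → Unrivalled M r h) T
    augmentation-or-unrivalled (stop _) _ _ = inj₂ []
    augmentation-or-unrivalled (link _ sk alt) (_ ∷ distinct-res) (_ ∷ distinct-hosp)
      with augmentation-or-unrivalled alt distinct-res distinct-hosp
    ... | inj₁ found            = inj₁ found
    ... | inj₂ rest-unrivalled with unrivalled-or-claimant sk
    ...   | inj₁ s-unrivalled = inj₂ (s-unrivalled ∷ rest-unrivalled)
    ...   | inj₂ c            = inj₁ (augment-at-claimant sk alt distinct-res distinct-hosp rest-unrivalled c)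

    walk⇒envyFreeAugmentingPath : AlternatingWalk M M* → EnvyFreeAugmentingPath M
    walk⇒envyFreeAugmentingPath (walk s k T s-free sk alt (_ ∷ distinct-res) distinct-hosp)
      with augmentation-or-unrivalled alt distinct-res distinct-hosp
    ... | inj₁ found         = found
    ... | inj₂ T-unrivalled = augment-at-claimant sk alt distinct-res distinct-hosp T-unrivalled first-claimant
      where
      first-claimant : Claimant k s
      first-claimant = [ claimant s s-free (IsMatching.⊆E M*-matching s k sk) ≤-refl , id ]′
                       (unrivalled-or-claimant sk)

lemma8 : (G : HRLQ)
    → (∀ h → HRLQ.qlow G h ≤ 1 × HRLQ.qup G h ≤ 1)
    → (∀ r → prefLength G r ≤ 2)
    → (M M* : EdgeSet G)
    → IsMatching G M → EnvyFree G M
    → IsMatching G M* → EnvyFree G M*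
    → size G M < size G M*
    → Σ (Path G) λ P → IsAugmentingPath G M P × IsMatching G (_⊕_ G M P) × EnvyFree G (_⊕_ G M P)
lemma8 G quotas degree≤2 M M* M-matching M-envyFree M*-matching M*-envyFree size< =
  walk⇒envyFreeAugmentingPath (alternatingWalk G M-1:1 M*-1:1 edgeCount<)
  where
  open Repair G (proj₂ ∘ quotas) degree≤2 M-matching M-envyFree M*-matching M*-envyFree
  edgeCount< = subst₂ _<_ (size≡edgeCount G M) (size≡edgeCount G M*) size<
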